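{- Let $Q$ be a quiver, $(\mathbf{i},\mathbf{a},\mu(\bullet))$ data as in the context, and $\lambda^\bullet$ a $Q_0$-tuple of weakly decreasing $\lambda^{(j)}\in\mathbb{Z}^{\nu^{(j)}}$. Then $\mathcal{K}^{\mathbf{i},\mathbf{a}}_{\lambda^\bullet,\mu(\bullet)}(t_{Q_1})=0$ unless $\lambda^\bullet\succeq\mu^\bullet$.
   Context: A quiver $Q=(Q_0,Q_1)$ is a finite directed graph (loops, multiple arrows allowed); $tb,hb$ are tail and head of $b$, $t_b$ an indeterminate per arrow. Data: $m\ge1$, $\mathbf{i}=(i_1,\dots,i_m)\in Q_0^m$, positive integers $\mathbf{a}=(a_1,\dots,a_m)$, $\mu(k)\in\mathbb{Z}^{a_k}$ weakly decreasing; $\nu^{(j)}=\sum_{k:i_k=j}a_k$. Variables $x(k)=(x(k)_1,\dots,x(k)_{a_k})$; $x^{(j)}=(x^{(j)}_1,\dots,x^{(j)}_{\nu^{(j)}})$ is the concatenation of the $x(k)$ with $i_k=j$ in increasing $k$; $\mu^{(j)}\in\mathbb{Z}^{\nu^{(j)}}$ is the analogous concatenation of the $\mu(k)$, and $\mu^\bullet=(\mu^{(j)})_j$. $x^{\mu(\bullet)}=\prod_k\prod_px(k)_p^{\mu(k)_p}$; $B_{\mathbf{i},\mathbf{a}}=\prod_{k<\ell}\prod_{b:tb=i_k,hb=i_\ell}\prod_{p,q}(1-t_bx(k)_p/x(\ell)_q)^{ -1}$ as a power series in $t$. With $S^\bullet=\prod_jS_{\nu^{(j)}}$ permuting each $x^{(j)}$,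 $J=\sum(-1)^ww$, $x^{\rho^\bullet}=\prod_j\prod_r(x^{(j)}_r)^{\nu^{(j)}-r}$, $D(f)=J(x^{\rho^\bullet})^{ -1}J(x^{\rho^\bullet}f)$, the quiver Kostka-Shoji polynomials are defined by $D(x^{\mu(\bullet)}B_{\mathbf{i},\mathbf{a}})=\sum_{\lambda^\bullet}\mathcal{K}^{\mathbf{i},\mathbf{a}}_{\lambda^\bullet,\mu(\bullet)}(t_{Q_1})\prod_js_{\lambda^{(j)}}(x^{(j)})$ (sum over $Q_0$-tuples of weakly decreasing integer vectors). Order $\succeq$: identify $\bigoplus_j\mathbb{Z}^{\nu^{(j)}}$ with the lattice with basis $\varepsilon(y)$ indexed by the variables $y$ (so $\varepsilon^{(j)}_r$ for $x^{(j)}_r$). Say $\lambda^\bullet\succeq\mu^\bullet$ if $\lambda^\bullet-\mu^\bullet$ lies in the $\mathbb{Z}_{\ge0}$-span of (i) the vectors $\varepsilon(x(k)_p)-\varepsilon(x(\ell)_q)$ for all $k<\ell$ such that some arrow $b$ has $tb=i_k$, $hb=i_\ell$, and all $p,q$; and (ii) the positive roots $\varepsilon^{(j)}_r-\varepsilon^{(j)}_{r'}$, $j\in Q_0$, $1\le r<r'\le\nu^{(j)}$. -}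

module Defs where

open import Data.Nat as ℕ using (ℕ; zero; suc; _∸_)
open import Data.Integer as ℤ using (ℤ; +_; -_; _+_; _-_; _*_)
open import Data.Fin as Fin using (Fin; toℕ)
open import Data.Fin.Properties using () renaming (_≟_ to _≟ᶠ_)
open import Data.List as List using (List; []; _∷_; [_]; map; concatMap; filter; filterᵇ; allFin; upTo; length; zipWith)
open import Data.Bool.ListAction using (and)
open import Data.Nat.ListAction using () renaming (sum to sumℕ)
open import Data.Product using (Σ; _,_; proj₁; proj₂; ∃; _×_)
open import Data.Product.Properties using (≡-dec)
open import Data.Bool using (Bool; true; false; if_then_else_; _∧_)
open import Data.Maybe using (Maybe; just; nothing; fromMaybe)
open import Relation.Binary.PropositionalEquality using (_≡_)
open import Relation.Nullary.Decidable using (⌊_⌋)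

record Quiver : Set where
  field
    V  : ℕ
    E  : ℕ
    tl : Fin E → Fin V
    hd : Fin E → Fin V

-- Data (i, a, μ(•)) : m, i_k ∈ Q₀, a_k, μ(k) ∈ ℤ^{a_k}.
-- (Hypotheses m ≥ 1, a_k ≥ 1, μ(k) weakly decreasing are stated in the theorem.)
record QData (Q : Quiver) : Set where
  field
    m : ℕ
    i : Fin m → Fin (Quiver.V Q)
    a : Fin m → ℕ
    μ : (k : Fin m) → Fin (a k) → ℤ

sumℤ : List ℤ → ℤ
sumℤ = List.foldr _+_ (+ 0)

nth : {A : Set} → List A → ℕ → Maybe A
nth []       _       = nothing
nth (x ∷ xs) zero    = just x
nth (x ∷ xs) (suc n) = nth xs n

insertions : {A : Set} → A → List A → List (List A)
insertions x []       = [ x ∷ [] ]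
insertions x (y ∷ ys) = (x ∷ y ∷ ys) ∷ map (y ∷_) (insertions x ys)

perms : {A : Set} → List A → List (List A)
perms []       = [ [] ]
perms (x ∷ xs) = concatMap (insertions x) (perms xs)

inversions : List ℕ → ℕ
inversions []       = 0
inversions (x ∷ xs) = length (filter (λ y → y ℕ.<? x) xs) ℕ.+ inversions xs

signℤ : ℕ → ℤ
signℤ zero          = + 1
signℤ (suc zero)    = - (+ 1)
signℤ (suc (suc n)) = signℤ n

module _ {Q : Quiver} (D : QData Q) where
  open Quiver Q
  open QData D

  -- the variables x(k)_p, indexed by (k , p)
  Var : Set
  Var = Σ (Fin m) (λ k → Fin (a k))

  _≟ᵛ_ : (y z : Var) → Relation.Nullary.Decidable.Dec (y ≡ z)
  _≟ᵛ_ = ≡-dec _≟ᶠ_ _≟ᶠ_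

  vtx : Var → Fin V
  vtx (k , p) = i k

  varList : List Var
  varList = concatMap (λ k → map (k ,_) (allFin (a k))) (allFin m)

  -- position of a variable in varList (0-based); this is the global order;
  -- within a vertex j it is the order of the concatenation x^{(j)}
  pos : Var → ℕ
  pos (k , p) = sumℕ (map a (filter (λ k' → toℕ k' ℕ.<? toℕ k) (allFin m))) ℕ.+ toℕ p

  -- exponent vectors = elements of ⊕_j ℤ^{ν^{(j)}}, basis ε(y)
  Exp : Set
  Exp = Var → ℤ

  ε : Var → Exp
  ε y z = if ⌊ y ≟ᵛ z ⌋ then + 1 else + 0

  μ• : Exp
  μ• (k , p) = μ k p

  -- ρ(y) = ν^{(j)} - r  where y = x^{(j)}_r
  ρ : Exp
  ρ y = + length (filterᵇ (λ y' → ⌊ vtx y' ≟ᶠ vtx y ⌋ ∧ ⌊ pos y ℕ.<? pos y' ⌋) varList)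

  Dominant : Exp → Set
  Dominant λ' = ∀ y y' → vtx y ≡ vtx y' → pos y ℕ.< pos y' → λ' y' ℤ.≤ λ' y

  dominant? : Exp → Bool
  dominant? λ' = and (concatMap (λ y → map (λ y' →
      if ⌊ vtx y ≟ᶠ vtx y' ⌋ ∧ ⌊ pos y ℕ.<? pos y' ⌋ then ⌊ λ' y' ℤ.≤? λ' y ⌋ else true)
      varList) varList)

  -- the group S^• : orderings π of varList which keep every variable at
  -- a position belonging to the same vertex; w_π(varList[r]) = π[r].
  Sbullet : List (List Var)
  Sbullet = filterᵇ (λ π → and (zipWith (λ y z → ⌊ vtx y ≟ᶠ vtx z ⌋) varList π))
                    (perms varList)

  perm : List Var → Var → Var
  perm π y = fromMaybe y (nth π (pos y))

  sgn : List Var → ℤ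
  sgn π = signℤ (inversions (map pos π))

  -- a (formal) series in the x's is given by its coefficient function
  -- Exp → ℤ.  Coefficient of x^β in J(g) = Σ_w (-1)^w w(g):
  Jcoef : (Exp → ℤ) → Exp → ℤ
  Jcoef g β = sumℤ (map (λ π → sgn π * g (λ y → β (perm π y))) Sbullet)

  TDeg : Set
  TDeg = Fin E → ℕ

  -- factors (1 - t_b x(k)_p / x(ℓ)_q)^{-1} of B_{i,a}:
  -- k < ℓ, tb = i_k, hb = i_ℓ, all p, q.  Stored as (b , x(k)_p , x(ℓ)_q).
  factors : List (Fin E × Var × Var)
  factors =
    concatMap (λ k → concatMap (λ ℓ →
      if ⌊ toℕ k ℕ.<? toℕ ℓ ⌋ then
        concatMap (λ b →
          if ⌊ tl b ≟ᶠ i k ⌋ ∧ ⌊ hd b ≟ᶠ i ℓ ⌋ then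
            concatMap (λ p → map (λ q → (b , (k , p) , (ℓ , q))) (allFin (a ℓ))) (allFin (a k))
          else []) (allFin E)
      else []) (allFin m)) (allFin m)

  -- coefficient of t^d x^β in the product of (1 - t_b x^y/x^z)^{-1} over a list of factors
  prodCoef : List (Fin E × Var × Var) → TDeg → Exp → ℤ
  prodCoef [] d β =
    if and (map (λ c → ⌊ d c ℕ.≟ 0 ⌋) (allFin E)) ∧ and (map (λ y → ⌊ β y ℤ.≟ + 0 ⌋) varList)
    then + 1 else + 0
  prodCoef ((b , y , z) ∷ fs) d β =
    sumℤ (map (λ n → prodCoef fs (λ c → if ⌊ c ≟ᶠ b ⌋ then d c ∸ n else d c)
                                 (λ v → β v - (+ n) * (ε y v - ε z v)))
              (upTo (suc (d b))))

  Bcoef : TDeg → Exp → ℤ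
  Bcoef = prodCoef factors

  -- Defining property of the quiver Kostka-Shoji polynomials:
  --   D(x^{μ(•)} B) = Σ_λ K_λ Π_j s_{λ^{(j)}}(x^{(j)}),
  -- with s_λ = J(x^{λ+ρ})/J(x^ρ); multiplied by J(x^ρ) and by linearity of J,
  --   J(x^ρ x^{μ(•)} B) = J(Σ_{λ dominant} K_λ x^{λ+ρ}),
  -- compared coefficientwise (coefficient of t^d x^β).
  -- K λ d is the coefficient of t^d in K_{λ,μ(•)}(t_{Q₁}).
  IsKostkaShoji : (Exp → TDeg → ℤ) → Set
  IsKostkaShoji K = ∀ (d : TDeg) (β : Exp) →
    Jcoef (λ γ → Bcoef d (λ y → γ y - ρ y - μ• y)) β
      ≡ Jcoef (λ γ → if dominant? (λ y → γ y - ρ y) then K (λ y → γ y - ρ y) d else + 0) β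

  data Gen : Var → Var → Set where
    arrowGen : ∀ (k ℓ : Fin m) (p : Fin (a k)) (q : Fin (a ℓ)) (b : Fin E) →
               toℕ k ℕ.< toℕ ℓ → tl b ≡ i k → hd b ≡ i ℓ → Gen (k , p) (ℓ , q)
    rootGen  : ∀ y y' → vtx y ≡ vtx y' → pos y ℕ.< pos y' → Gen y y'

  data Cone : Exp → Set where
    cone0    : ∀ v → (∀ y → v y ≡ + 0) → Cone v
    coneStep : ∀ v y y' → Gen y y' → Cone v →
               ∀ w → (∀ z → w z ≡ v z + (ε y z - ε y' z)) → Cone w

  _≽_ : Exp → Exp → Set
  λ' ≽ μ' = Cone (λ z → λ' z - μ' z)

module Submission where

-- Put β = λ + ρ and compare the coefficients of t^d x^β on both sides of the defining
-- identity J(x^ρ x^{μ(•)} B) = J(Σ_λ K_λ x^{λ+ρ}), with J = Σ_{w ∈ S^•} (-1)^w w.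
--  * Left side: the term of w is ± the coefficient of B at wβ - ρ - μ.  Every monomial
--    of B has exponent in the cone of ≽ (its factors are generators of type (i)), and for
--    dominant β the difference β - wβ is a nonnegative combination of positive roots
--    (type (ii)), obtained by sorting w back to 1 with transpositions.  A nonzero term
--    would thus put λ - μ = (β - wβ) + (wβ - ρ - μ) in the cone; so the left side is 0.
--  * Right side: the term of w contributes only if wβ - ρ is dominant; as β is strictly
--    dominant this forces w = 1, so the right side is c · K_λ with c ≥ 1.
-- Hence K_λ = 0.

open import Defs
open import Data.Nat using (ℕ; _≤_; _<_)
open import Data.Fin using (Fin; toℕ)
open import Data.Integer using (ℤ; +_) renaming (_≤_ to _≤ℤ_)
open import Relation.Binary.PropositionalEquality using (_≡_)
open import Relation.Nullary using (¬_)

open import Data.Nat using (zero; suc; z≤n; s≤s)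
import Data.Nat as ℕ
import Data.Nat.Properties as ℕP
import Data.Integer as ℤ
open import Data.Integer using (_+_; _-_; _*_)
import Data.Integer.Properties as ℤP
open import Data.Integer.Solver using (module +-*-Solver)
import Data.Fin as Fin
import Data.Fin.Properties as FinP
open import Data.List using (List; []; _∷_; map; concatMap; filter; filterᵇ; allFin; upTo; length; _++_; tabulate; zipWith)
open import Data.List.Properties using (map-∘; length-map; length-tabulate; filter-none; map-tabulate; concatMap-map; concatMap-cong; map-concatMap)
open import Data.List.Relation.Unary.Any using (here; there)
import Data.List.Relation.Unary.All as All
open import Data.List.Membership.Propositional using (_∈_; find; lose)
open import Data.List.Membership.Propositional.Properties using (∈-map⁺; ∈-map⁻; ∈-concatMap⁺; ∈-concatMap⁻; ∈-filter⁺; ∈-filter⁻)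
open import Data.List.Relation.Binary.Permutation.Propositional using (_↭_; prep; swap; ↭-refl; ↭-trans; ↭-sym; ↭⇒↭ₛ)
open import Data.List.Relation.Binary.Permutation.Propositional.Properties using (∈-resp-↭; ↭-length)
import Data.List.Relation.Binary.Permutation.Setoid.Properties as PermSetoid
open import Data.List.Relation.Unary.Unique.Propositional using (Unique; []; _∷_)
open import Data.Nat.ListAction using () renaming (sum to sumℕ)
open import Data.Bool.ListAction using (and)
open import Data.Bool using (Bool; true; false; if_then_else_; _∧_; T?)
open import Data.Bool.Properties using (T-≡; ∧-zeroʳ)
open import Data.Product using (Σ; _,_; proj₁; proj₂; ∃; _×_)
open import Data.Sum using (_⊎_; inj₁; inj₂)
import Data.Maybe as Maybe
open import Data.Maybe.Properties using (just-injective)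
open import Data.Maybe using (just; nothing; fromMaybe)
open import Data.Empty using (⊥-elim)
open import Function using (_∘_; id; Equivalence)
open import Relation.Binary.PropositionalEquality using (_≢_; refl; sym; trans; cong; cong₂; subst; subst₂; setoid; module ≡-Reasoning)
open import Relation.Nullary using (Dec; yes; no; does)
open import Relation.Nullary.Decidable using (⌊_⌋; isYes≗does; dec-true; dec-false; toWitness)

witness : ∀ {P : Set} (d : Dec P) → ⌊ d ⌋ ≡ true → P
witness d e = toWitness (Equivalence.from T-≡ e)

⌊⌋-true : ∀ {P : Set} (d : Dec P) → P → ⌊ d ⌋ ≡ true
⌊⌋-true d p = trans (isYes≗does d) (dec-true d p)

⌊⌋-false : ∀ {P : Set} (d : Dec P) → ¬ P → ⌊ d ⌋ ≡ false
⌊⌋-false d ¬p = trans (isYes≗does d) (dec-false d ¬p)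

∧-true : ∀ b c → b ∧ c ≡ true → b ≡ true × c ≡ true
∧-true true true refl = refl , refl

and-true⁻ : ∀ bs → and bs ≡ true → ∀ {b} → b ∈ bs → b ≡ true
and-true⁻ (c ∷ bs) e (here refl) = proj₁ (∧-true c _ e)
and-true⁻ (c ∷ bs) e (there b∈) = and-true⁻ bs (proj₂ (∧-true c _ e)) b∈

and-true⁺ : ∀ bs → (∀ {b} → b ∈ bs → b ≡ true) → and bs ≡ true
and-true⁺ []       h = refl
and-true⁺ (c ∷ bs) h rewrite h (here refl) = and-true⁺ bs (h ∘ there)

nth-++ˡ : ∀ {A : Set} (xs ys : List A) r → r < length xs → nth (xs ++ ys) r ≡ nth xs r
nth-++ˡ (x ∷ xs) ys zero    _        = refl
nth-++ˡ (x ∷ xs) ys (suc r) (s≤s r<) = nth-++ˡ xs ys r r<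

nth-++ʳ : ∀ {A : Set} (xs ys : List A) r → nth (xs ++ ys) (length xs ℕ.+ r) ≡ nth ys r
nth-++ʳ []       ys r = refl
nth-++ʳ (x ∷ xs) ys r = nth-++ʳ xs ys r

nth-map : ∀ {A B : Set} (f : A → B) xs r → nth (map f xs) r ≡ Maybe.map f (nth xs r)
nth-map f []       r       = refl
nth-map f (x ∷ xs) zero    = refl
nth-map f (x ∷ xs) (suc r) = nth-map f xs r

nth-map⁻ : ∀ {A B : Set} (f : A → B) xs r {y} → nth (map f xs) r ≡ just y → ∃ λ x → nth xs r ≡ just x × f x ≡ y
nth-map⁻ f (x ∷ xs) zero    refl = x , refl , refl
nth-map⁻ f (x ∷ xs) (suc r) e    = nth-map⁻ f xs r e

nth-tabulate : ∀ {A : Set} n (f : Fin n → A) (p : Fin n) → nth (tabulate f) (toℕ p) ≡ just (f p)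
nth-tabulate (suc n) f Fin.zero    = refl
nth-tabulate (suc n) f (Fin.suc p) = nth-tabulate n (f ∘ Fin.suc) p

nth-tabulate⁻ : ∀ {A : Set} n (f : Fin n → A) r {x} → nth (tabulate f) r ≡ just x →
                ∃ λ p → toℕ p ≡ r × f p ≡ x
nth-tabulate⁻ (suc n) f zero    refl = Fin.zero , refl , refl
nth-tabulate⁻ (suc n) f (suc r) e with nth-tabulate⁻ n (f ∘ Fin.suc) r e
... | p , refl , fp≡x = Fin.suc p , refl , fp≡x

nth-allFin⁻ : ∀ n r {p : Fin n} → nth (allFin n) r ≡ just p → toℕ p ≡ r
nth-allFin⁻ n r e with nth-tabulate⁻ n id r e
... | _ , r≡ , refl = r≡

∈⇒nth : ∀ {A : Set} {x : A} {xs} → x ∈ xs → ∃ λ r → nth xs r ≡ just x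
∈⇒nth (here refl) = 0 , refl
∈⇒nth (there x∈)  with ∈⇒nth x∈
... | r , e = suc r , e

nth⇒∈ : ∀ {A : Set} {x : A} xs r → nth xs r ≡ just x → x ∈ xs
nth⇒∈ (y ∷ xs) zero    refl = here refl
nth⇒∈ (y ∷ xs) (suc r) e    = there (nth⇒∈ xs r e)

nth⇒< : ∀ {A : Set} (xs : List A) r {x} → nth xs r ≡ just x → r < length xs
nth⇒< (y ∷ xs) zero    e = s≤s z≤n
nth⇒< (y ∷ xs) (suc r) e = s≤s (nth⇒< xs r e)

<⇒nth : ∀ {A : Set} (xs : List A) r → r < length xs → ∃ λ x → nth xs r ≡ just x
<⇒nth (x ∷ xs) zero    _        = x , refl
<⇒nth (x ∷ xs) (suc r) (s≤s r<) = <⇒nth xs r r<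

NthInjective : ∀ {A : Set} → List A → Set
NthInjective xs = ∀ r s {x} → nth xs r ≡ just x → nth xs s ≡ just x → r ≡ s

nth-injective⇒Unique : ∀ {A : Set} (xs : List A) → NthInjective xs → Unique xs
nth-injective⇒Unique []       _   = []
nth-injective⇒Unique (x ∷ xs) inj =
  All.tabulate x∉ ∷ nth-injective⇒Unique xs (λ r s e e' → ℕP.suc-injective (inj (suc r) (suc s) e e'))
  where
  x∉ : ∀ {y} → y ∈ xs → x ≢ y
  x∉ y∈ refl with ∈⇒nth y∈
  ... | r , e with inj 0 (suc r) refl e
  ... | ()

Unique⇒nth-injective : ∀ {A : Set} (xs : List A) → Unique xs → NthInjective xs
Unique⇒nth-injective (y ∷ xs) (_  ∷ u) zero    zero    e    e'   = refl
Unique⇒nth-injective (y ∷ xs) (y∉ ∷ u) zero    (suc s) refl e'   = ⊥-elim (All.lookup y∉ (nth⇒∈ xs s e') refl)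
Unique⇒nth-injective (y ∷ xs) (y∉ ∷ u) (suc r) zero    e    refl = ⊥-elim (All.lookup y∉ (nth⇒∈ xs r e) refl)
Unique⇒nth-injective (y ∷ xs) (_  ∷ u) (suc r) (suc s) e    e'   = cong suc (Unique⇒nth-injective xs u r s e e')

∈-if : ∀ {A : Set} c {xs : List A} {x} → x ∈ (if c then xs else []) → c ≡ true × x ∈ xs
∈-if true x∈ = refl , x∈

and-zipWith⁻ : ∀ {A : Set} (f : A → A → Bool) xs ys r {x y} → and (zipWith f xs ys) ≡ true →
               nth xs r ≡ just x → nth ys r ≡ just y → f x y ≡ true
and-zipWith⁻ f (x ∷ xs) (y ∷ ys) zero    e refl refl = proj₁ (∧-true (f x y) _ e)
and-zipWith⁻ f (x ∷ xs) (y ∷ ys) (suc r) e ex   ey   = and-zipWith⁻ f xs ys r (proj₂ (∧-true (f x y) _ e)) ex ey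

and-zipWith-diagonal : ∀ {A : Set} (f : A → A → Bool) xs → (∀ x → f x x ≡ true) → and (zipWith f xs xs) ≡ true
and-zipWith-diagonal f []       refl-f = refl
and-zipWith-diagonal f (x ∷ xs) refl-f rewrite refl-f x = and-zipWith-diagonal f xs refl-f

insertions-↭ : ∀ {A : Set} (x : A) ys {zs} → zs ∈ insertions x ys → zs ↭ x ∷ ys
insertions-↭ x []       (here refl) = ↭-refl
insertions-↭ x (y ∷ ys) (here refl) = ↭-refl
insertions-↭ x (y ∷ ys) (there zs∈) with ∈-map⁻ (y ∷_) zs∈
... | ws , ws∈ , refl = ↭-trans (prep y (insertions-↭ x ys ws∈)) (swap y x ↭-refl)

perms-↭ : ∀ {A : Set} (L : List A) {zs} → zs ∈ perms L → zs ↭ L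
perms-↭ []      (here refl) = ↭-refl
perms-↭ (x ∷ L) zs∈ with find (∈-concatMap⁻ (insertions x) {xs = perms L} zs∈)
... | ys , ys∈ , zs∈′ = ↭-trans (insertions-↭ x ys zs∈′) (prep x (perms-↭ L ys∈))

perms-refl : ∀ {A : Set} (L : List A) → L ∈ perms L
perms-refl []      = here refl
perms-refl (x ∷ L) = ∈-concatMap⁺ (insertions x) {xs = perms L} (lose (perms-refl L) (head-insertion L))
  where
  head-insertion : ∀ L → (x ∷ L) ∈ insertions x L
  head-insertion []      = here refl
  head-insertion (_ ∷ _) = here refl

sumℤ-zero : ∀ {A : Set} (f : A → ℤ) xs → (∀ {x} → x ∈ xs → f x ≡ + 0) → sumℤ (map f xs) ≡ + 0
sumℤ-zero f []       h = refl
sumℤ-zero f (x ∷ xs) h rewrite h (here refl) | sumℤ-zero f xs (h ∘ there) = refl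

sumℤ-nonzero : ∀ {A : Set} (f : A → ℤ) xs → sumℤ (map f xs) ≢ + 0 → ∃ λ x → f x ≢ + 0
sumℤ-nonzero f []       s≢0 = ⊥-elim (s≢0 refl)
sumℤ-nonzero f (x ∷ xs) s≢0 with f x ℤ.≟ + 0
... | no  fx≢0 = x , fx≢0
... | yes fx≡0 = sumℤ-nonzero f xs (λ e → s≢0 (cong₂ _+_ fx≡0 e))

sumℤ-indicator : ∀ {A : Set} (f : A → ℤ) (b : A → Bool) k xs →
                 (∀ {x} → x ∈ xs → f x ≡ (if b x then k else + 0)) →
                 sumℤ (map f xs) ≡ + length (filterᵇ b xs) * k
sumℤ-indicator f b k []       h = refl
sumℤ-indicator f b k (x ∷ xs) h with b x | h (here refl)
... | false | fx≡0 = trans (cong₂ _+_ fx≡0 (sumℤ-indicator f b k xs (h ∘ there))) (ℤP.+-identityˡ _)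
... | true  | fx≡k = begin
  f x + sumℤ (map f xs)                   ≡⟨ cong₂ _+_ fx≡k (sumℤ-indicator f b k xs (h ∘ there)) ⟩
  k + + length (filterᵇ b xs) * k         ≡⟨ cong (_+ + length (filterᵇ b xs) * k) (sym (ℤP.*-identityˡ k)) ⟩
  + 1 * k + + length (filterᵇ b xs) * k   ≡⟨ sym (ℤP.*-distribʳ-+ k (+ 1) (+ length (filterᵇ b xs))) ⟩
  (+ 1 + + length (filterᵇ b xs)) * k     ≡⟨ cong (_* k) (sym (ℤP.pos-+ 1 (length (filterᵇ b xs)))) ⟩
  + suc (length (filterᵇ b xs)) * k       ∎
  where open ≡-Reasoning

positive-multiple-zero : ∀ {c} k → 0 < c → + c * k ≡ + 0 → k ≡ + 0
positive-multiple-zero {suc c} k _ ck≡0 with ℤP.i*j≡0⇒i≡0∨j≡0 (+ suc c) ck≡0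
... | inj₂ k≡0 = k≡0

filterᵇ-length-≤ : ∀ {A : Set} (p q : A → Bool) xs → (∀ x → p x ≡ true → q x ≡ true) →
                   length (filterᵇ p xs) ≤ length (filterᵇ q xs)
filterᵇ-length-≤ p q []       p⇒q = z≤n
filterᵇ-length-≤ p q (x ∷ xs) p⇒q with p x in px | q x in qx
... | true  | true  = s≤s (filterᵇ-length-≤ p q xs p⇒q)
... | true  | false with trans (sym (p⇒q x px)) qx
...   | ()
filterᵇ-length-≤ p q (x ∷ xs) p⇒q | false | true  = ℕP.m≤n⇒m≤1+n (filterᵇ-length-≤ p q xs p⇒q)
filterᵇ-length-≤ p q (x ∷ xs) p⇒q | false | false = filterᵇ-length-≤ p q xs p⇒q

filterᵇ-length-< : ∀ {A : Set} (p q : A → Bool) xs {w} → (∀ x → p x ≡ true → q x ≡ true) →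
                   w ∈ xs → q w ≡ true → p w ≡ false → length (filterᵇ p xs) < length (filterᵇ q xs)
filterᵇ-length-< p q (x ∷ xs) p⇒q (here refl) qw pw rewrite qw | pw = s≤s (filterᵇ-length-≤ p q xs p⇒q)
filterᵇ-length-< p q (x ∷ xs) p⇒q (there w∈)  qw pw with p x in px | q x in qx
... | true  | true  = s≤s (filterᵇ-length-< p q xs p⇒q w∈ qw pw)
... | true  | false with trans (sym (p⇒q x px)) qx
...   | ()
filterᵇ-length-< p q (x ∷ xs) p⇒q (there w∈) qw pw | false | true  = ℕP.m≤n⇒m≤1+n (filterᵇ-length-< p q xs p⇒q w∈ qw pw)
filterᵇ-length-< p q (x ∷ xs) p⇒q (there w∈) qw pw | false | false = filterᵇ-length-< p q xs p⇒q w∈ qw pw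

filterᵇ-nonempty : ∀ {A : Set} (b : A → Bool) xs {x} → x ∈ xs → b x ≡ true → 0 < length (filterᵇ b xs)
filterᵇ-nonempty b (y ∷ xs) (here refl) bx rewrite bx = s≤s z≤n
filterᵇ-nonempty b (y ∷ xs) (there x∈)  bx with b y
... | true  = s≤s z≤n
... | false = filterᵇ-nonempty b xs x∈ bx

filter-map : ∀ {A B : Set} {P : B → Set} {R : A → Set} (P? : ∀ y → Dec (P y)) (R? : ∀ x → Dec (R x)) (f : A → B) →
             (∀ x → does (P? (f x)) ≡ does (R? x)) →
             ∀ xs → filter P? (map f xs) ≡ map f (filter R? xs)
filter-map P? R? f agree []       = refl
filter-map P? R? f agree (x ∷ xs) rewrite agree x with does (R? x)
... | true  = cong (f x ∷_) (filter-map P? R? f agree xs)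
... | false = filter-map P? R? f agree xs

inversions-sorted : ∀ {A : Set} (key : A → ℕ) xs c → (∀ i {z} → nth xs i ≡ just z → key z ≡ c ℕ.+ i) →
                    inversions (map key xs) ≡ 0
inversions-sorted key []       c keys = refl
inversions-sorted key (x ∷ xs) c keys =
  cong₂ ℕ._+_ (cong length (filter-none (λ y → y ℕ.<? key x) (All.tabulate no-smaller)))
              (inversions-sorted key xs (suc c) (λ i e → trans (keys (suc i) e) (ℕP.+-suc c i)))
  where
  no-smaller : ∀ {y} → y ∈ map key xs → ¬ (y < key x)
  no-smaller y∈ y<x with ∈-map⁻ key y∈
  ... | z , z∈ , refl with ∈⇒nth z∈
  ... | i , e rewrite keys (suc i) e | keys 0 refl | ℕP.+-identityʳ c =
    ℕP.<-irrefl refl (ℕP.<-trans y<x (ℕP.m<m+n c (s≤s z≤n)))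

Cell : (m : ℕ) → (Fin m → ℕ) → Set
Cell m a = Σ (Fin m) (λ k → Fin (a k))

cells : ∀ m (a : Fin m → ℕ) → List (Cell m a)
cells m a = concatMap (λ k → map (k ,_) (allFin (a k))) (allFin m)

rowOffset : ∀ m (a : Fin m → ℕ) → Fin m → ℕ
rowOffset m a k = sumℕ (map a (filter (λ k' → toℕ k' ℕ.<? toℕ k) (allFin m)))

index : ∀ m (a : Fin m → ℕ) → Cell m a → ℕ
index m a (k , p) = rowOffset m a k ℕ.+ toℕ p

firstRow : ∀ m (a : Fin (suc m) → ℕ) → List (Cell (suc m) a)
firstRow m a = map (Fin.zero ,_) (allFin (a Fin.zero))

shiftRow : ∀ {m} {a : Fin (suc m) → ℕ} → Cell m (a ∘ Fin.suc) → Cell (suc m) a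
shiftRow (k , p) = Fin.suc k , p

firstRow-length : ∀ m (a : Fin (suc m) → ℕ) → length (firstRow m a) ≡ a Fin.zero
firstRow-length m a = trans (length-map _ (allFin (a Fin.zero))) (length-tabulate id)

cells-suc : ∀ m (a : Fin (suc m) → ℕ) → cells (suc m) a ≡ firstRow m a ++ map shiftRow (cells m (a ∘ Fin.suc))
cells-suc m a = cong (firstRow m a ++_) (begin
  concatMap row (tabulate Fin.suc)                         ≡⟨ cong (concatMap row) (sym (map-tabulate id Fin.suc)) ⟩
  concatMap row (map Fin.suc (allFin m))                   ≡⟨ concatMap-map row Fin.suc (allFin m) ⟩
  concatMap (row ∘ Fin.suc) (allFin m)                     ≡⟨ concatMap-cong (λ k → map-∘ (allFin (a (Fin.suc k)))) (allFin m) ⟩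
  concatMap (map shiftRow ∘ row′) (allFin m)               ≡⟨ sym (map-concatMap shiftRow row′ (allFin m)) ⟩
  map shiftRow (cells m (a ∘ Fin.suc))                     ∎)
  where
  open ≡-Reasoning
  row : (k : Fin (suc m)) → List (Cell (suc m) a)
  row k = map (k ,_) (allFin (a k))
  row′ : (k : Fin m) → List (Cell m (a ∘ Fin.suc))
  row′ k = map (k ,_) (allFin (a (Fin.suc k)))

rowOffset-zero : ∀ m (a : Fin (suc m) → ℕ) → rowOffset (suc m) a Fin.zero ≡ 0
rowOffset-zero m a = cong (sumℕ ∘ map a) (filter-none (λ k' → toℕ k' ℕ.<? 0) {xs = allFin (suc m)} (All.tabulate (λ _ ())))

rowOffset-suc : ∀ m (a : Fin (suc m) → ℕ) k → rowOffset (suc m) a (Fin.suc k) ≡ a Fin.zero ℕ.+ rowOffset m (a ∘ Fin.suc) k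
rowOffset-suc m a k = cong (a Fin.zero ℕ.+_) (begin
  sumℕ (map a (filter below (tabulate Fin.suc)))              ≡⟨ cong (sumℕ ∘ map a ∘ filter below) (sym (map-tabulate id Fin.suc)) ⟩
  sumℕ (map a (filter below (map Fin.suc (allFin m))))        ≡⟨ cong (sumℕ ∘ map a) (filter-map below below′ Fin.suc (λ _ → refl) (allFin m)) ⟩
  sumℕ (map a (map Fin.suc (filter below′ (allFin m))))       ≡⟨ cong sumℕ (sym (map-∘ (filter below′ (allFin m)))) ⟩
  rowOffset m (a ∘ Fin.suc) k                                 ∎)
  where
  open ≡-Reasoning
  below : ∀ (k' : Fin (suc m)) → Dec (toℕ k' < toℕ (Fin.suc k))
  below k' = toℕ k' ℕ.<? toℕ (Fin.suc k)
  below′ : ∀ (k' : Fin m) → Dec (toℕ k' < toℕ k)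
  below′ k' = toℕ k' ℕ.<? toℕ k

nth-index : ∀ m a (c : Cell m a) → nth (cells m a) (index m a c) ≡ just c
nth-index (suc m) a (Fin.zero , p) rewrite cells-suc m a | rowOffset-zero m a = begin
  nth (firstRow m a ++ _) (toℕ p)                  ≡⟨ nth-++ˡ (firstRow m a) _ (toℕ p) p<len ⟩
  nth (firstRow m a) (toℕ p)                       ≡⟨ nth-map (Fin.zero ,_) (allFin (a Fin.zero)) (toℕ p) ⟩
  Maybe.map (Fin.zero ,_) (nth (allFin _) (toℕ p)) ≡⟨ cong (Maybe.map (Fin.zero ,_)) (nth-tabulate _ id p) ⟩
  just (Fin.zero , p)                              ∎
  where
  open ≡-Reasoning
  p<len : toℕ p < length (firstRow m a)
  p<len = subst (toℕ p <_) (sym (firstRow-length m a)) (FinP.toℕ<n p)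
nth-index (suc m) a (Fin.suc k , p)
  rewrite cells-suc m a | rowOffset-suc m a k | ℕP.+-assoc (a Fin.zero) (rowOffset m (a ∘ Fin.suc) k) (toℕ p) = begin
  nth (firstRow m a ++ rest) (a Fin.zero ℕ.+ i)           ≡⟨ cong (λ n → nth (firstRow m a ++ rest) (n ℕ.+ i)) (sym (firstRow-length m a)) ⟩
  nth (firstRow m a ++ rest) (length (firstRow m a) ℕ.+ i) ≡⟨ nth-++ʳ (firstRow m a) rest i ⟩
  nth rest i                                              ≡⟨ nth-map shiftRow (cells m (a ∘ Fin.suc)) i ⟩
  Maybe.map shiftRow (nth (cells m (a ∘ Fin.suc)) i)      ≡⟨ cong (Maybe.map shiftRow) (nth-index m (a ∘ Fin.suc) (k , p)) ⟩
  just (Fin.suc k , p)                                    ∎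
  where
  open ≡-Reasoning
  rest = map shiftRow (cells m (a ∘ Fin.suc))
  i = index m (a ∘ Fin.suc) (k , p)

index-nth : ∀ m a r {c : Cell m a} → nth (cells m a) r ≡ just c → index m a c ≡ r
index-nth (suc m) a r e rewrite cells-suc m a with r ℕ.<? a Fin.zero
... | yes r<a with nth-map⁻ (Fin.zero ,_) (allFin _) r (trans (sym (nth-++ˡ (firstRow m a) _ r r<len)) e)
  where r<len = subst (r <_) (sym (firstRow-length m a)) r<a
...   | p , nth≡p , refl = trans (cong (ℕ._+ toℕ p) (rowOffset-zero m a)) (nth-allFin⁻ _ r nth≡p)
index-nth (suc m) a r e | no r≮a
  with nth-map⁻ shiftRow (cells m (a ∘ Fin.suc)) r′ (trans (sym (nth-++ʳ (firstRow m a) rest r′)) (subst (λ n → nth (firstRow m a ++ rest) n ≡ just _) r≡ e))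
  where
  rest = map shiftRow (cells m (a ∘ Fin.suc))
  r′ = r ℕ.∸ a Fin.zero
  r≡ : r ≡ length (firstRow m a) ℕ.+ r′
  r≡ = trans (sym (ℕP.m+[n∸m]≡n (ℕP.≮⇒≥ r≮a))) (cong (ℕ._+ r′) (sym (firstRow-length m a)))
... | (k , p) , nth≡kp , refl = begin
  rowOffset (suc m) a (Fin.suc k) ℕ.+ toℕ p                   ≡⟨ cong (ℕ._+ toℕ p) (rowOffset-suc m a k) ⟩
  a Fin.zero ℕ.+ rowOffset m (a ∘ Fin.suc) k ℕ.+ toℕ p        ≡⟨ ℕP.+-assoc (a Fin.zero) _ (toℕ p) ⟩
  a Fin.zero ℕ.+ index m (a ∘ Fin.suc) (k , p)                ≡⟨ cong (a Fin.zero ℕ.+_) (index-nth m (a ∘ Fin.suc) _ nth≡kp) ⟩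
  a Fin.zero ℕ.+ (r ℕ.∸ a Fin.zero)                           ≡⟨ ℕP.m+[n∸m]≡n (ℕP.≮⇒≥ r≮a) ⟩
  r                                                           ∎
  where open ≡-Reasoning

module _ {Q : Quiver} (D : QData Q) where
  open Quiver Q
  open QData D

  nth-pos : ∀ y → nth (varList D) (pos D y) ≡ just y
  nth-pos = nth-index m a

  pos-nth : ∀ r {y} → nth (varList D) r ≡ just y → pos D y ≡ r
  pos-nth = index-nth m a

  pos-injective : ∀ {y y'} → pos D y ≡ pos D y' → y ≡ y'
  pos-injective {y} {y'} e with trans (sym (nth-pos y)) (trans (cong (nth (varList D)) e) (nth-pos y'))
  ... | refl = refl

  ∈-varList : ∀ y → y ∈ varList D
  ∈-varList y = nth⇒∈ (varList D) (pos D y) (nth-pos y)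

  pos<length : ∀ y → pos D y < length (varList D)
  pos<length y = nth⇒< (varList D) (pos D y) (nth-pos y)

  varList-unique : Unique (varList D)
  varList-unique = nth-injective⇒Unique (varList D) (λ r s e e' → trans (sym (pos-nth r e)) (pos-nth s e'))

  variable-at : ∀ n → (∃ λ y → pos D y ≡ n) ⊎ (∀ y → pos D y ≢ n)
  variable-at n with n ℕ.<? length (varList D)
  ... | yes n<N = let (y , e) = <⇒nth (varList D) n n<N in inj₁ (y , pos-nth n e)
  ... | no  n≮N = inj₂ (λ y e → n≮N (subst (_< length (varList D)) e (pos<length y)))

  ε-same : ∀ y → ε D y y ≡ + 1
  ε-same y with _≟ᵛ_ D y y
  ... | yes _   = refl
  ... | no  y≢y = ⊥-elim (y≢y refl)

  ε-other : ∀ y z → y ≢ z → ε D y z ≡ + 0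
  ε-other y z y≢z with _≟ᵛ_ D y z
  ... | yes y≡z = ⊥-elim (y≢z y≡z)
  ... | no  _   = refl

  cone-cong : ∀ {v w} → Cone D v → (∀ z → v z ≡ w z) → Cone D w
  cone-cong (cone0 v v≡0)               v≡w = cone0 _ (λ z → trans (sym (v≡w z)) (v≡0 z))
  cone-cong (coneStep v y y' g c _ step) v≡w = coneStep v y y' g c _ (λ z → trans (sym (v≡w z)) (step z))

  cone-+ : ∀ {u v} → Cone D u → Cone D v → Cone D (λ z → u z + v z)
  cone-+ {v = v} (cone0 u u≡0) cv = cone-cong cv (λ z → sym (trans (cong (_+ v z) (u≡0 z)) (ℤP.+-identityˡ (v z))))
  cone-+ {v = v} (coneStep u y y' g cu _ step) cv =
    coneStep _ y y' g (cone-+ cu cv) _ (λ z → trans (cong (_+ v z) (step z)) (+-swapʳ (u z) (ε D y z - ε D y' z) (v z)))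
    where
    open +-*-Solver
    +-swapʳ : ∀ x e w → (x + e) + w ≡ (x + w) + e
    +-swapʳ = solve 3 (λ x e w → (x :+ e) :+ w := (x :+ w) :+ e) refl

  cone-multiple : ∀ {y y'} → Gen D y y' → ∀ n {v} → Cone D v → Cone D (λ z → v z + + n * (ε D y z - ε D y' z))
  cone-multiple {y} {y'} g zero {v} c =
    cone-cong c (λ z → sym (trans (cong (_+_ (v z)) (ℤP.*-zeroˡ (ε D y z - ε D y' z))) (ℤP.+-identityʳ (v z))))
  cone-multiple {y} {y'} g (suc n) {v} c =
    coneStep _ y y' g (cone-multiple g n c) _ (λ z → trans (cong (λ k → v z + k * (ε D y z - ε D y' z)) (ℤP.pos-+ 1 n))
                                                          (unfold (v z) (+ n) (ε D y z - ε D y' z)))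
    where
    open +-*-Solver
    unfold : ∀ x k e → x + (+ 1 + k) * e ≡ (x + k * e) + e
    unfold = solve 3 (λ x k e → x :+ (con (+ 1) :+ k) :* e := (x :+ k :* e) :+ e) refl

  Generates : Fin E × Var D × Var D → Set
  Generates (b , y , z) = Gen D y z

  prodCoef-support : ∀ fs → (∀ {f} → f ∈ fs → Generates f) → ∀ d β → prodCoef D fs d β ≢ + 0 → Cone D β
  prodCoef-support [] _ d β coef≢0 = cone0 β β≡0
    where
    nonzero-test : ∀ (c : Bool) → (if c then + 1 else + 0) ≢ + 0 → c ≡ true
    nonzero-test true  _   = refl
    nonzero-test false ≢0 = ⊥-elim (≢0 refl)
    β≡0 : ∀ y → β y ≡ + 0
    β≡0 y = witness (β y ℤ.≟ + 0)
      (and-true⁻ _ (proj₂ (∧-true _ _ (nonzero-test _ coef≢0))) (∈-map⁺ (λ y → ⌊ β y ℤ.≟ + 0 ⌋) (∈-varList y)))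
  prodCoef-support ((b , y , z) ∷ fs) gens d β coef≢0 with sumℤ-nonzero _ (upTo (suc (d b))) coef≢0
  ... | n , term≢0 = cone-cong (cone-multiple (gens (here refl)) n (prodCoef-support fs (gens ∘ there) _ _ term≢0))
                               (λ v → cancel (β v) (+ n) (ε D y v - ε D z v))
    where
    open +-*-Solver
    cancel : ∀ x k e → (x - k * e) + k * e ≡ x
    cancel = solve 3 (λ x k e → (x :- k :* e) :+ k :* e := x) refl

  factors-generate : ∀ {f} → f ∈ factors D → Generates f
  factors-generate f∈ with find (∈-concatMap⁻ _ {xs = allFin m} f∈)
  ... | k , _ , f∈₁ with find (∈-concatMap⁻ _ {xs = allFin m} f∈₁)
  ... | ℓ , _ , f∈₂ with ∈-if _ f∈₂
  ... | k<ℓ , f∈₃ with find (∈-concatMap⁻ _ {xs = allFin E} f∈₃)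
  ... | b , _ , f∈₄ with ∈-if _ f∈₄
  ... | ends , f∈₅ with find (∈-concatMap⁻ _ {xs = allFin (a k)} f∈₅)
  ... | p , _ , f∈₆ with ∈-map⁻ (λ q → (b , (k , p) , (ℓ , q))) f∈₆
  ... | q , _ , refl = arrowGen k ℓ p q b (witness (toℕ k ℕ.<? toℕ ℓ) k<ℓ)
                         (witness (tl b FinP.≟ i k) (proj₁ (∧-true _ _ ends)))
                         (witness (hd b FinP.≟ i ℓ) (proj₂ (∧-true _ _ ends)))

  Bcoef-support : ∀ d β → Bcoef D d β ≢ + 0 → Cone D β
  Bcoef-support = prodCoef-support (factors D) factors-generate

  -- Vertex-preserving bijections of the variables, i.e. the elements of S^•.
  record BlockBijection (σ : Var D → Var D) : Set where
    field
      preserves-vtx  : ∀ y → vtx D (σ y) ≡ vtx D y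
      injective      : ∀ {y y'} → σ y ≡ σ y' → y ≡ y'
      preimage       : Var D → Var D
      image-preimage : ∀ z → σ (preimage z) ≡ z

  transposition : Var D → Var D → Var D → Var D
  transposition s t z with _≟ᵛ_ D z s
  ... | yes _ = t
  ... | no  _ with _≟ᵛ_ D z t
  ...   | yes _ = s
  ...   | no  _ = z

  transposition-left : ∀ s t → transposition s t s ≡ t
  transposition-left s t with _≟ᵛ_ D s s
  ... | yes _   = refl
  ... | no  s≢s = ⊥-elim (s≢s refl)

  transposition-right : ∀ s t → transposition s t t ≡ s
  transposition-right s t with _≟ᵛ_ D t s
  ... | yes t≡s = t≡s
  ... | no  _ with _≟ᵛ_ D t t
  ...   | yes _   = refl
  ...   | no  t≢t = ⊥-elim (t≢t refl)

  transposition-other : ∀ s t z → z ≢ s → z ≢ t → transposition s t z ≡ z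
  transposition-other s t z z≢s z≢t with _≟ᵛ_ D z s
  ... | yes z≡s = ⊥-elim (z≢s z≡s)
  ... | no  _ with _≟ᵛ_ D z t
  ...   | yes z≡t = ⊥-elim (z≢t z≡t)
  ...   | no  _   = refl

  transposition-involutive : ∀ s t z → transposition s t (transposition s t z) ≡ z
  transposition-involutive s t z with _≟ᵛ_ D z s
  ... | yes refl = transposition-right z t
  ... | no  z≢s with _≟ᵛ_ D z t
  ...   | yes refl = transposition-left s z
  ...   | no  z≢t  = transposition-other s t z z≢s z≢t

  transposition-vtx : ∀ s t → vtx D s ≡ vtx D t → ∀ z → vtx D (transposition s t z) ≡ vtx D z
  transposition-vtx s t s~t z with _≟ᵛ_ D z s
  ... | yes refl = sym s~t
  ... | no  _ with _≟ᵛ_ D z t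
  ...   | yes refl = s~t
  ...   | no  _    = refl

  ∘-transposition : ∀ {σ} → BlockBijection σ → ∀ s t → vtx D s ≡ vtx D t → BlockBijection (σ ∘ transposition s t)
  ∘-transposition {σ} B s t s~t = record
    { preserves-vtx  = λ y → trans (preserves-vtx (transposition s t y)) (transposition-vtx s t s~t y)
    ; injective      = λ {y} {y'} e → trans (sym (transposition-involutive s t y))
                                      (trans (cong (transposition s t) (injective e)) (transposition-involutive s t y'))
    ; preimage       = λ z → transposition s t (preimage z)
    ; image-preimage = λ z → trans (cong σ (transposition-involutive s t (preimage z))) (image-preimage z)
    }
    where open BlockBijection B

  -- Pointwise identity behind one exchange step: composing σ with the transposition of
  -- s and t = σ s changes β - β∘σ by a multiple of the root ε(s) - ε(t).
  swap-difference : ∀ (β : Exp D) (σ : Var D → Var D) s t → s ≢ t → σ s ≡ t → ∀ z →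
                    (β z - β (σ (transposition s t z))) + (β (σ t) - β t) * (ε D s z - ε D t z) ≡ β z - β (σ z)
  swap-difference β σ s t s≢t σs≡t z = by-cases (_≟ᵛ_ D z s) (_≟ᵛ_ D z t)
    where
    open +-*-Solver
    at-s : ∀ x u v → (x - u) + (u - v) * (+ 1 - + 0) ≡ x - v
    at-s = solve 3 (λ x u v → (x :- u) :+ (u :- v) :* (con (+ 1) :- con (+ 0)) := x :- v) refl
    at-t : ∀ x u → (x - x) + (u - x) * (+ 0 - + 1) ≡ x - u
    at-t = solve 2 (λ x u → (x :- x) :+ (u :- x) :* (con (+ 0) :- con (+ 1)) := x :- u) refl
    elsewhere : ∀ x k → x + k * (+ 0 - + 0) ≡ x
    elsewhere = solve 2 (λ x k → x :+ k :* (con (+ 0) :- con (+ 0)) := x) refl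

    by-cases : Dec (z ≡ s) → Dec (z ≡ t) →
               (β z - β (σ (transposition s t z))) + (β (σ t) - β t) * (ε D s z - ε D t z) ≡ β z - β (σ z)
    by-cases (yes z≡s) _ rewrite z≡s | transposition-left s t | ε-same s | ε-other t s (s≢t ∘ sym) | σs≡t =
      at-s (β s) (β (σ t)) (β t)
    by-cases (no z≢s) (yes z≡t) rewrite z≡t | transposition-right s t | ε-same t | ε-other s t s≢t | σs≡t =
      at-t (β t) (β (σ t))
    by-cases (no z≢s) (no z≢t) rewrite transposition-other s t z z≢s z≢t | ε-other s z (z≢s ∘ sym) | ε-other t z (z≢t ∘ sym) =
      elsewhere (β z - β (σ z)) (β (σ t) - β t)

  StrictlyDominant : Exp D → Set
  StrictlyDominant β = ∀ y y' → vtx D y ≡ vtx D y' → pos D y < pos D y' → β y' ℤ.< β y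

  dominant-cong : ∀ {g h : Exp D} → (∀ y → g y ≡ h y) → Dominant D g → Dominant D h
  dominant-cong g≡h dg y y' y~y' y<y' = subst₂ _≤ℤ_ (g≡h y') (g≡h y) (dg y y' y~y' y<y')

  dominant+strict : ∀ {g h : Exp D} → Dominant D g → StrictlyDominant h → StrictlyDominant (λ y → g y + h y)
  dominant+strict dg sh y y' y~y' y<y' = ℤP.+-mono-≤-< (dg y y' y~y' y<y') (sh y y' y~y' y<y')

  strict⇒dominant : ∀ {g : Exp D} → StrictlyDominant g → Dominant D g
  strict⇒dominant sg y y' y~y' y<y' = ℤP.<⇒≤ (sg y y' y~y' y<y')

  -- ρ(y) counts the later variables at the vertex of y, so it strictly decreases.
  ρ-strictly-dominant : StrictlyDominant (ρ D)
  ρ-strictly-dominant y y' y~y' y<y' = ℤ.+<+ (filterᵇ-length-< (later y') (later y) (varList D) later-y'⇒later-y (∈-varList y') y'-later-y y'-not-later-y')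
    where
    later : Var D → Var D → Bool
    later v w = ⌊ vtx D w FinP.≟ vtx D v ⌋ ∧ ⌊ pos D v ℕ.<? pos D w ⌋
    later-y'⇒later-y : ∀ w → later y' w ≡ true → later y w ≡ true
    later-y'⇒later-y w e with ∧-true _ _ e
    ... | same , after = cong₂ _∧_ (⌊⌋-true (vtx D w FinP.≟ vtx D y) (trans (witness (vtx D w FinP.≟ vtx D y') same) (sym y~y')))
                                   (⌊⌋-true (pos D y ℕ.<? pos D w) (ℕP.<-trans y<y' (witness (pos D y' ℕ.<? pos D w) after)))
    y'-later-y : later y y' ≡ true
    y'-later-y = cong₂ _∧_ (⌊⌋-true (vtx D y' FinP.≟ vtx D y) (sym y~y')) (⌊⌋-true (pos D y ℕ.<? pos D y') y<y')
    y'-not-later-y' : later y' y' ≡ false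
    y'-not-later-y' = trans (cong (⌊ vtx D y' FinP.≟ vtx D y' ⌋ ∧_) (⌊⌋-false (pos D y' ℕ.<? pos D y') (ℕP.<-irrefl refl))) (∧-zeroʳ _)

  dominanceTest : Exp D → Var D → Var D → Bool
  dominanceTest g y y' = if ⌊ vtx D y FinP.≟ vtx D y' ⌋ ∧ ⌊ pos D y ℕ.<? pos D y' ⌋ then ⌊ g y' ℤ.≤? g y ⌋ else true

  dominant?-sound : ∀ g → dominant? D g ≡ true → Dominant D g
  dominant?-sound g e y y' y~y' y<y' = witness (g y' ℤ.≤? g y) (trans (sym test≡) (and-true⁻ _ e test∈))
    where
    test∈ : dominanceTest g y y' ∈ concatMap (λ v → map (dominanceTest g v) (varList D)) (varList D)
    test∈ = ∈-concatMap⁺ _ {xs = varList D} (lose (∈-varList y) (∈-map⁺ _ (∈-varList y')))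
    test≡ : dominanceTest g y y' ≡ ⌊ g y' ℤ.≤? g y ⌋
    test≡ rewrite ⌊⌋-true (vtx D y FinP.≟ vtx D y') y~y' | ⌊⌋-true (pos D y ℕ.<? pos D y') y<y' = refl

  dominant?-complete : ∀ g → Dominant D g → dominant? D g ≡ true
  dominant?-complete g dg = and-true⁺ _ every-test
    where
    passes : ∀ y y' → dominanceTest g y y' ≡ true
    passes y y' with vtx D y FinP.≟ vtx D y' | pos D y ℕ.<? pos D y'
    ... | yes y~y' | yes y<y' = ⌊⌋-true (g y' ℤ.≤? g y) (dg y y' y~y' y<y')
    ... | yes _    | no  _    = refl
    ... | no  _    | _        = refl
    every-test : ∀ {b} → b ∈ concatMap (λ v → map (dominanceTest g v) (varList D)) (varList D) → b ≡ true
    every-test b∈ with find (∈-concatMap⁻ _ {xs = varList D} b∈)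
    ... | y , _ , b∈′ with ∈-map⁻ (dominanceTest g y) b∈′
    ... | y' , _ , refl = passes y y'

  -- Downward induction over positions: σ fixes every variable from position n on.

  FixedFrom : (Var D → Var D) → ℕ → Set
  FixedFrom σ n = ∀ y → n ≤ pos D y → σ y ≡ y

  fixed-from-length : ∀ σ → FixedFrom σ (length (varList D))
  fixed-from-length σ y N≤pos = ⊥-elim (ℕP.<-irrefl refl (ℕP.<-≤-trans (pos<length y) N≤pos))

  fixed-from-pred : ∀ {σ n} → FixedFrom σ (suc n) → (∀ y → pos D y ≡ n → σ y ≡ y) → FixedFrom σ n
  fixed-from-pred {n = n} fixed at-n y n≤pos with pos D y ℕ.≟ n
  ... | yes pos≡n = at-n y pos≡n
  ... | no  pos≢n = fixed y (ℕP.≤∧≢⇒< n≤pos (pos≢n ∘ sym))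

  moved-below : ∀ {σ n y* w} → BlockBijection σ → FixedFrom σ (suc n) → pos D y* ≡ n → w ≢ y* →
                σ w ≡ y* ⊎ σ y* ≡ w → pos D w < n
  moved-below {σ} {n} {y*} {w} B fixed pos≡n w≢y* exchanged with pos D w ℕ.<? n
  ... | yes w<n = w<n
  ... | no  w≮n with pos D w ℕ.≟ n
  ...   | yes w≡n = ⊥-elim (w≢y* (pos-injective (trans w≡n (sym pos≡n))))
  ...   | no  w≢n with fixed w (ℕP.≤∧≢⇒< (ℕP.≮⇒≥ w≮n) (w≢n ∘ sym)) | exchanged
  ...     | σw≡w | inj₁ σw≡y* = ⊥-elim (w≢y* (trans (sym σw≡w) σw≡y*))
  ...     | σw≡w | inj₂ σy*≡w = ⊥-elim (w≢y* (sym (BlockBijection.injective B (trans σy*≡w (sym σw≡w)))))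

  fixed-or-moved : ∀ {σ n} → FixedFrom σ (suc n) → FixedFrom σ n ⊎ ∃ λ y* → pos D y* ≡ n × σ y* ≢ y*
  fixed-or-moved {σ} {n} fixed with variable-at n
  ... | inj₂ empty = inj₁ (fixed-from-pred fixed (λ y pos≡n → ⊥-elim (empty y pos≡n)))
  ... | inj₁ (y* , pos≡n) with _≟ᵛ_ D (σ y*) y*
  ...   | no  moved = inj₂ (y* , pos≡n , moved)
  ...   | yes σy*≡y* = inj₁ (fixed-from-pred fixed at-n)
    where
    at-n : ∀ y → pos D y ≡ n → σ y ≡ y
    at-n y pos≡n′ with pos-injective (trans pos≡n′ (sym pos≡n))
    ... | refl = σy*≡y*

  module Moved {σ n y*} (B : BlockBijection σ) (fixed : FixedFrom σ (suc n)) (pos≡n : pos D y* ≡ n) (moved : σ y* ≢ y*) where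
    open BlockBijection B

    s : Var D
    s = preimage y*

    s≢y* : s ≢ y*
    s≢y* s≡y* = moved (trans (cong σ (sym s≡y*)) (image-preimage y*))

    s~y* : vtx D s ≡ vtx D y*
    s~y* = trans (sym (preserves-vtx s)) (cong (vtx D) (image-preimage y*))

    s<n : pos D s < n
    s<n = moved-below B fixed pos≡n s≢y* (inj₁ (image-preimage y*))

    σy*<n : pos D (σ y*) < n
    σy*<n = moved-below B fixed pos≡n moved (inj₂ refl)

    swapped : BlockBijection (σ ∘ transposition s y*)
    swapped = ∘-transposition B s y* s~y*

    swapped-fixed : FixedFrom (σ ∘ transposition s y*) n
    swapped-fixed y n≤pos = by-cases (_≟ᵛ_ D y s) (_≟ᵛ_ D y y*)
      where
      by-cases : Dec (y ≡ s) → Dec (y ≡ y*) → σ (transposition s y* y) ≡ y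
      by-cases (yes refl) _ = ⊥-elim (ℕP.<-irrefl refl (ℕP.<-≤-trans s<n n≤pos))
      by-cases (no _) (yes refl) = trans (cong σ (transposition-right s y)) (image-preimage y)
      by-cases (no y≢s) (no y≢y*) = trans (cong σ (transposition-other s y* y y≢s y≢y*))
                                          (fixed y (ℕP.≤∧≢⇒< n≤pos (λ n≡pos → y≢y* (pos-injective (trans (sym n≡pos) (sym pos≡n))))))

  -- For β dominant, β - β∘σ is a nonnegative combination of positive roots: sort σ back
  -- to the identity by transpositions, each contributing a nonnegative root multiple.
  dominant-exchange : ∀ {β} → Dominant D β → ∀ n {σ} → BlockBijection σ → FixedFrom σ n → Cone D (λ z → β z - β (σ z))
  dominant-exchange {β} dβ zero {σ} B fixed =
    cone0 _ (λ z → trans (cong (λ w → β z - β w) (fixed z z≤n)) (ℤP.+-inverseʳ (β z)))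
  dominant-exchange {β} dβ (suc n) {σ} B fixed with fixed-or-moved fixed
  ... | inj₁ fixed′ = dominant-exchange dβ n B fixed′
  ... | inj₂ (y* , pos≡n , moved) =
    cone-cong (cone-multiple root ℤ.∣ gap ∣ (dominant-exchange dβ n swapped swapped-fixed))
              (λ z → trans (cong (λ k → (β z - β (σ (transposition s y* z))) + k * (ε D s z - ε D y* z)) (ℤP.0≤i⇒+∣i∣≡i gap≥0))
                           (swap-difference β σ s y* s≢y* (BlockBijection.image-preimage B y*) z))
    where
    open Moved B fixed pos≡n moved
    root : Gen D s y*
    root = rootGen s y* s~y* (subst (pos D s <_) (sym pos≡n) s<n)
    gap : ℤ
    gap = β (σ y*) - β y*
    gap≥0 : + 0 ≤ℤ gap
    gap≥0 = ℤP.i≤j⇒0≤j-i (dβ (σ y*) y* (BlockBijection.preserves-vtx B y*) (subst (pos D (σ y*) <_) (sym pos≡n) σy*<n))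

  strictly-dominant-rigid : ∀ {β} → StrictlyDominant β → ∀ {σ} → BlockBijection σ → Dominant D (β ∘ σ) →
                            ∀ n → FixedFrom σ n → ∀ y → σ y ≡ y
  strictly-dominant-rigid sβ B dβσ zero    fixed y = fixed y z≤n
  strictly-dominant-rigid {β} sβ {σ} B dβσ (suc n) fixed with fixed-or-moved fixed
  ... | inj₁ fixed′ = strictly-dominant-rigid sβ B dβσ n fixed′
  ... | inj₂ (y* , pos≡n , moved) = ⊥-elim (ℤP.<-irrefl refl (ℤP.<-≤-trans β-rises β-falls))
    where
    open Moved B fixed pos≡n moved
    β-rises : β y* ℤ.< β (σ y*)
    β-rises = sβ (σ y*) y* (BlockBijection.preserves-vtx B y*) (subst (pos D (σ y*) <_) (sym pos≡n) σy*<n)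
    β-falls : β (σ y*) ≤ℤ β y*
    β-falls = subst (λ v → β (σ y*) ≤ℤ β v) (BlockBijection.image-preimage B y*)
                    (dβσ s y* s~y* (subst (pos D s <_) (sym pos≡n) s<n))

  -- The orderings enumerated by `Sbullet` are exactly presentations of elements of S^•.

  sameVertices : List (Var D) → Bool
  sameVertices π = and (zipWith (λ y z → ⌊ vtx D y FinP.≟ vtx D z ⌋) (varList D) π)

  identity-ordering : varList D ∈ Sbullet D
  identity-ordering = ∈-filter⁺ (T? ∘ sameVertices) (perms-refl (varList D))
    (Equivalence.from T-≡ (and-zipWith-diagonal _ (varList D) (λ y → ⌊⌋-true (vtx D y FinP.≟ vtx D y) refl)))

  perm-identity : ∀ y → perm D (varList D) y ≡ y
  perm-identity y = cong (fromMaybe y) (nth-pos y)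

  module Ordering {π} (π∈ : π ∈ Sbullet D) where
    private
      N = length (varList D)
      filtered = ∈-filter⁻ (T? ∘ sameVertices) {xs = perms (varList D)} π∈

      π↭ : π ↭ varList D
      π↭ = perms-↭ (varList D) (proj₁ filtered)

      length-π : length π ≡ N
      length-π = ↭-length π↭

      π-unique : Unique π
      π-unique = PermSetoid.Unique-resp-↭ (setoid (Var D)) (↭⇒↭ₛ (↭-sym π↭)) (varList-unique)

    σ : Var D → Var D
    σ = perm D π

    nth-π : ∀ y → nth π (pos D y) ≡ just (σ y)
    nth-π y with nth π (pos D y) in e
    ... | just _  = refl
    ... | nothing with <⇒nth π (pos D y) (subst (pos D y <_) (sym length-π) (pos<length y))
    ...   | _ , e′ with trans (sym e) e′
    ...     | ()

    preimage : ∀ z → ∃ λ s → σ s ≡ z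
    preimage z with ∈⇒nth (∈-resp-↭ (↭-sym π↭) (∈-varList z))
    ... | r , nth≡z with <⇒nth (varList D) r (subst (r <_) length-π (nth⇒< π r nth≡z))
    ... | s , nth≡s = s , just-injective (trans (sym (nth-π s)) (trans (cong (nth π) (pos-nth r nth≡s)) nth≡z))

    bijection : BlockBijection σ
    bijection = record
      { preserves-vtx  = λ y → sym (witness (vtx D y FinP.≟ vtx D (σ y))
                                 (and-zipWith⁻ _ (varList D) π (pos D y) (Equivalence.to T-≡ (proj₂ filtered)) (nth-pos y) (nth-π y)))
      ; injective      = λ {y} {y'} σy≡σy' → pos-injective (Unique⇒nth-injective π π-unique (pos D y) (pos D y')
                                                 (nth-π y) (trans (nth-π y') (cong just (sym σy≡σy'))))
      ; preimage       = λ z → proj₁ (preimage z)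
      ; image-preimage = λ z → proj₂ (preimage z)
      }

    -- The identity of S^• has sign +1: its ordering lists the variables by position.
    sgn-identity : (∀ y → σ y ≡ y) → sgn D π ≡ + 1
    sgn-identity σ≡id = cong signℤ (inversions-sorted (pos D) π 0 positions)
      where
      positions : ∀ r {z} → nth π r ≡ just z → pos D z ≡ r
      positions r {z} nth≡z with <⇒nth (varList D) r (subst (r <_) length-π (nth⇒< π r nth≡z))
      ... | s , nth≡s with trans (sym nth≡z) (trans (cong (nth π) (sym (pos-nth r nth≡s))) (trans (nth-π s) (cong just (σ≡id s))))
      ... | refl = pos-nth r nth≡s

  -- The term of w ∈ S^• is a
  -- coefficient of B at wβ - ρ - μ, which is in the cone if nonzero; adding β - wβ, also
  -- in the cone, would put β - ρ - μ in the cone.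
  lhs-coefficient-vanishes : ∀ d β → Dominant D β → ¬ Cone D (λ z → β z - ρ D z - μ• D z) →
                             Jcoef D (λ γ → Bcoef D d (λ y → γ y - ρ D y - μ• D y)) β ≡ + 0
  lhs-coefficient-vanishes d β dβ outside = sumℤ-zero _ (Sbullet D) term-vanishes
    where
    term-vanishes : ∀ {π} → π ∈ Sbullet D → sgn D π * Bcoef D d (λ y → β (perm D π y) - ρ D y - μ• D y) ≡ + 0
    term-vanishes {π} π∈ with Bcoef D d (λ y → β (perm D π y) - ρ D y - μ• D y) ℤ.≟ + 0
    ... | yes coef≡0 = trans (cong (sgn D π *_) coef≡0) (ℤP.*-zeroʳ (sgn D π))
    ... | no  coef≢0 = ⊥-elim (outside (cone-cong in-cone telescope))
      where
      open Ordering π∈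
      in-cone : Cone D (λ z → (β z - β (σ z)) + (β (σ z) - ρ D z - μ• D z))
      in-cone = cone-+ (dominant-exchange dβ (length (varList D)) bijection (fixed-from-length σ)) (Bcoef-support d _ coef≢0)
      open +-*-Solver
      telescope : ∀ z → (β z - β (σ z)) + (β (σ z) - ρ D z - μ• D z) ≡ β z - ρ D z - μ• D z
      telescope z = solve 4 (λ b b′ r u → (b :- b′) :+ ((b′ :- r) :- u) := (b :- r) :- u) refl (β z) (β (σ z)) (ρ D z) (μ• D z)

  -- Right-hand side: at β = λ + ρ with λ dominant, the term of w contributes only when
  -- wβ - ρ is dominant, which forces w = 1 because β is strictly dominant.  So the
  -- coefficient is c · K_λ, where c ≥ 1 counts the contributing orderings.
  rhs-coefficient : ∀ (K : Exp D → TDeg D → ℤ) → (∀ (λ₁ λ₂ : Exp D) → (∀ y → λ₁ y ≡ λ₂ y) → ∀ d → K λ₁ d ≡ K λ₂ d) →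
                    ∀ d (λ' : Exp D) → Dominant D λ' → ∃ λ c → 0 < c ×
                    Jcoef D (λ γ → if dominant? D (λ y → γ y - ρ D y) then K (λ y → γ y - ρ D y) d else + 0) (λ y → λ' y + ρ D y)
                      ≡ + c * K λ' d
  rhs-coefficient K K-ext d λ' dλ =
    length (filterᵇ contributes (Sbullet D)) ,
    filterᵇ-nonempty contributes (Sbullet D) identity-ordering identity-contributes ,
    sumℤ-indicator _ contributes (K λ' d) (Sbullet D) term
    where
    β : Exp D
    β y = λ' y + ρ D y
    open +-*-Solver
    shift-back : ∀ x r → (x + r) - r ≡ x
    shift-back = solve 2 (λ x r → (x :+ r) :- r := x) refl
    contributes : List (Var D) → Bool
    contributes π = dominant? D (λ y → β (perm D π y) - ρ D y)

    identity-contributes : contributes (varList D) ≡ true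
    identity-contributes = dominant?-complete _ (dominant-cong (λ y → sym (trans (cong (λ v → β v - ρ D y) (perm-identity y))
                                                                            (shift-back (λ' y) (ρ D y)))) dλ)

    term : ∀ {π} → π ∈ Sbullet D →
           sgn D π * (if contributes π then K (λ y → β (perm D π y) - ρ D y) d else + 0) ≡ (if contributes π then K λ' d else + 0)
    term {π} π∈ with contributes π in contributes≡
    ... | false = ℤP.*-zeroʳ (sgn D π)
    ... | true  = begin
      sgn D π * K (λ y → β (σ y) - ρ D y) d  ≡⟨ cong₂ _*_ (sgn-identity σ≡id) (K-ext _ λ' (λ y → trans (cong (λ v → β v - ρ D y) (σ≡id y)) (shift-back (λ' y) (ρ D y))) d) ⟩
      + 1 * K λ' d                            ≡⟨ ℤP.*-identityˡ (K λ' d) ⟩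
      K λ' d                                  ∎
      where
      open ≡-Reasoning
      open Ordering π∈
      dominant-βσ : Dominant D (β ∘ σ)
      dominant-βσ = dominant-cong (λ y → solve 2 (λ x r → (x :- r) :+ r := x) refl (β (σ y)) (ρ D y))
                      (strict⇒dominant (dominant+strict (dominant?-sound _ contributes≡) ρ-strictly-dominant))
      σ≡id : ∀ y → σ y ≡ y
      σ≡id = strictly-dominant-rigid (dominant+strict dλ ρ-strictly-dominant) bijection dominant-βσ
                                     (length (varList D)) (fixed-from-length σ)

lemma2p19 : (Q : Quiver) (D : QData Q) →
    1 ≤ QData.m D →
    (∀ k → 1 ≤ QData.a D k) →
    (∀ k (p q : Fin (QData.a D k)) → toℕ p ≤ toℕ q → QData.μ D k q ≤ℤ QData.μ D k p) →
    (K : Exp D → TDeg D → ℤ) →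
    (∀ (λ₁ λ₂ : Exp D) → (∀ y → λ₁ y ≡ λ₂ y) → ∀ d → K λ₁ d ≡ K λ₂ d) →
    IsKostkaShoji D K →
    (λ' : Exp D) → Dominant D λ' →
    ¬ (_≽_ D λ' (μ• D)) →
    ∀ (d : TDeg D) → K λ' d ≡ + 0
lemma2p19 Q D _ _ _ K K-ext kostka-shoji λ' dλ λ⋡μ d =
  let (c , c>0 , rhs≡cK) = rhs-coefficient D K K-ext d λ' dλ
      lhs≡0              = lhs-coefficient-vanishes D d β dβ β-outside
  in positive-multiple-zero (K λ' d) c>0 (trans (sym rhs≡cK) (trans (sym (kostka-shoji d β)) lhs≡0))
  where
  β : Exp D
  β y = λ' y + ρ D y
  dβ : Dominant D β
  dβ = strict⇒dominant D (dominant+strict D dλ (ρ-strictly-dominant D))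
  open +-*-Solver
  β-outside : ¬ Cone D (λ z → β z - ρ D z - μ• D z)
  β-outside c = λ⋡μ (cone-cong D c (λ z → solve 3 (λ x r u → ((x :+ r) :- r) :- u := x :- u) refl (λ' z) (ρ D z) (μ• D z)))
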